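{- Let $P(x)=\sum_{n\ge 0}p_n\frac{x^n}{n!}$, $P^e(x)=\sum_{n\ge 0}p_n^e\frac{x^n}{n!}$ and $P^o(x)=\sum_{n\ge 0}p_n^o\frac{x^n}{n!}$. Then \[ P^e(x)=\frac12\left(P(x)+\frac{x^2}{2}+x+1\right),\qquad P^o(x)=\frac12\left(P(x)-\frac{x^2}{2}-x-1\right). \]
   Context: A permutation $\sigma$ of $[n]=\{1,\dots,n\}$, in one-line notation, is a PAP (parity alternating permutation) if $\sigma(i)\equiv i\pmod 2$ for all $i$ (entries alternate in parity, first entry odd); the empty permutation of $[0]$ is a PAP, and it is even. $p_n$ is the number of PAPs of $[n]$, and $p_n^e$, $p_n^o$ the numbers of even and odd PAPs of $[n]$, where a permutation is even/odd according to its sign $(-1)^{n-c}$, $c$ being its number of cycles (fixed points included). -}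

module Defs where

open import Data.Nat using (ℕ; zero; suc; _∸_; _!; _≤ᵇ_)
open import Data.Nat.Properties using (_!≢0)
open import Data.Bool using (Bool; true; false; _∧_; not; if_then_else_)
open import Data.Fin using (Fin; toℕ)
open import Data.Fin.Properties using (_≟_)
open import Data.Vec using (Vec; []; _∷_; lookup; toList)
open import Data.List as L using (List; []; _∷_; concatMap; length; filterᵇ; allFin; upTo)
open import Relation.Nullary.Decidable using (⌊_⌋)
open import Data.Integer using (+_)
open import Data.Rational as ℚ using (ℚ; _/_; ½; 0ℚ; 1ℚ)

-- Permutations of [n] in one-line notation.
-- A vector v : Vec (Fin n) n encodes the map σ(i+1) = (lookup v i) + 1,
-- i.e. positions and values are shifted down by one (0-based).

words : (m n : ℕ) → List (Vec (Fin m) n)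
words m zero    = [] ∷ []
words m (suc n) = concatMap (λ v → L.map (_∷ v) (allFin m)) (words m n)

allᵇ : ∀ {A : Set} → (A → Bool) → List A → Bool
allᵇ f []       = true
allᵇ f (x ∷ xs) = f x ∧ allᵇ f xs

distinct : ∀ {m} → List (Fin m) → Bool
distinct []       = true
distinct (x ∷ xs) = allᵇ (λ y → not ⌊ x ≟ y ⌋) xs ∧ distinct xs

isPerm : ∀ {n} → Vec (Fin n) n → Bool
isPerm v = distinct (toList v)

isEven : ℕ → Bool
isEven zero          = true
isEven (suc zero)    = false
isEven (suc (suc k)) = isEven k

-- σ(i) ≡ i (mod 2) for all i (parity of i+1 equals parity of i, shift is harmless)
parityAlternating : ∀ {n} → Vec (Fin n) n → Bool
parityAlternating {n} v =
  allᵇ (λ i → if isEven (toℕ (lookup v i)) then isEven (toℕ i) else not (isEven (toℕ i))) (allFin n)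

isPAP : ∀ {n} → Vec (Fin n) n → Bool
isPAP v = isPerm v ∧ parityAlternating v

iter : ∀ {n} → Vec (Fin n) n → ℕ → Fin n → Fin n
iter v zero    i = i
iter v (suc k) i = lookup v (iter v k i)

isCycleMin : ∀ {n} → Vec (Fin n) n → Fin n → Bool
isCycleMin {n} v i = allᵇ (λ k → toℕ i ≤ᵇ toℕ (iter v k i)) (upTo n)

-- number of cycles (fixed points included) = number of cycle minima
cycles : ∀ {n} → Vec (Fin n) n → ℕ
cycles {n} v = length (filterᵇ (isCycleMin v) (allFin n))

-- sign (-1)^(n - c) is +1
isEvenPerm : ∀ {n} → Vec (Fin n) n → Bool
isEvenPerm {n} v = isEven (n ∸ cycles v)

paps : (n : ℕ) → List (Vec (Fin n) n)
paps n = filterᵇ isPAP (words n n)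

p : ℕ → ℕ
p n = length (paps n)

pᵉ : ℕ → ℕ
pᵉ n = length (filterᵇ isEvenPerm (paps n))

pᵒ : ℕ → ℕ
pᵒ n = length (filterᵇ (λ v → not (isEvenPerm v)) (paps n))

FPS : Set
FPS = ℕ → ℚ

egf : (ℕ → ℕ) → FPS
egf a n = (+ a n / (n !)) {{n !≢0}}

_⊕_ : FPS → FPS → FPS
(f ⊕ g) n = f n ℚ.+ g n

_⊖_ : FPS → FPS → FPS
(f ⊖ g) n = f n ℚ.- g n

_⊛_ : ℚ → FPS → FPS
(c ⊛ f) n = c ℚ.* f n

quad : FPS
quad zero                = 1ℚ
quad (suc zero)          = 1ℚ
quad (suc (suc zero))    = ½
quad (suc (suc (suc _))) = 0ℚ

P Pᵉ Pᵒ : FPS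
P  = egf p
Pᵉ = egf pᵉ
Pᵒ = egf pᵒ

module Submission where

-- For n ≥ 3, exchanging the first and third entries of a word is an involution on the PAPs of [n],
-- since positions 1 and 3 are both odd. On permutations it is σ ↦ σ ∘ (1 3), and composing with a
-- transposition (a b) either cuts the cycle through a and b into two or fuses the cycles of a and b
-- into one; either way the number of cycles changes by one, so the sign flips. Hence
-- p_n^e = p_n^o = p_n / 2 for n ≥ 3, while for n ≤ 2 the identity is the only PAP: that is where
-- the correction x²/2 + x + 1 = Σ_{n ≤ 2} xⁿ/n! comes from.

open import Defs
open import Data.Bool using (Bool; true; false; T; T?; _∧_; _∨_; not; if_then_else_)
open import Data.Bool.Properties using (T-∧; T-∨; ∧-zeroʳ; ∧-distribˡ-∨; not-involutive; ∧-commutativeMonoid)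
open import Algebra.Solver.CommutativeMonoid ∧-commutativeMonoid using (_⊜_) renaming (solve to ∧-solve; _⊕_ to _∧′_)
open import Data.Fin using (Fin; toℕ; zero; suc; fromℕ<)
open import Data.Fin.Properties using (_≟_; suc-injective; toℕ-injective; toℕ-fromℕ<; toℕ<n; pigeonhole; any?)
open import Data.Fin.Permutation.Components using (transpose)
open import Data.Vec using (Vec; []; _∷_; lookup; toList)
open import Data.List using (List; []; _∷_; _++_; map; concatMap; allFin; upTo; filterᵇ; length; tabulate)
open import Data.List.Properties using (length-tabulate; length-filter)
open import Data.List.Membership.Propositional using (_∈_)
open import Data.List.Membership.Propositional.Properties using (∈-upTo⁺)
open import Data.List.Relation.Unary.Any using (here; there)
open import Data.Nat using (ℕ; zero; suc; _+_; _*_; _∸_; _≤_; _<_; z≤n; s≤s; _≤ᵇ_; _!; NonZero)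
open import Data.Nat.DivMod using (_%_; _/_; m≡m%n+[m/n]*n; m%n<n)
open import Data.Nat.Properties
  using ( _!≢0; +-suc; +-assoc; +-commutativeSemigroup; ≤∧≢⇒<; ≤-trans; ≤-antisym; <-≤-trans; <⇒≤; n<1+n; ≤-pred
        ; m∸n≤m; m<n⇒0<n∸m; m+[n∸m]≡n; m∸n+n≡m; ≤ᵇ⇒≤; ≤⇒≤ᵇ; m≤n⇒m<n∨m≡n)
open import Algebra.Properties.CommutativeSemigroup +-commutativeSemigroup using (interchange)
open import Data.Integer as ℤ using ()
import Data.Integer.Properties as ℤₚ
open import Data.Integer.Solver using () renaming (module +-*-Solver to ℤ-Solver)
open import Data.Rational as ℚ using (ℚ; ½; 0ℚ; toℚᵘ)
import Data.Rational.Properties as ℚₚ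
open import Data.Rational.Unnormalised as ℚᵘ using (mkℚᵘ; *≡*)
import Data.Rational.Unnormalised.Properties as ℚᵘₚ
open import Data.Product using (∃; ∃-syntax; _×_; _,_; proj₁; proj₂)
open import Data.Sum as Sum using (_⊎_; inj₁; inj₂)
open import Function using (_∘_; id; Equivalence; case_of_)
open import Function.Definitions using (Injective)
open import Relation.Nullary using (Dec; yes; no; ¬_; contradiction)
open import Relation.Nullary.Decidable using (⌊_⌋; dec-true; dec-false; toWitness; fromWitness; toWitnessFalse)
open import Relation.Binary.PropositionalEquality

T-injective : ∀ {x y} → (T x → T y) → (T y → T x) → x ≡ y
T-injective {false} {false} _ _ = refl
T-injective {false} {true}  _ y⇒x = contradiction _ y⇒x
T-injective {true}  {false} x⇒y _ = contradiction _ x⇒y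
T-injective {true}  {true}  _ _ = refl

∧-not-congˡ-¬T : ∀ {x y} c → (¬ T c → x ≡ y) → x ∧ not c ≡ y ∧ not c
∧-not-congˡ-¬T {x} {y} true  _ = trans (∧-zeroʳ x) (sym (∧-zeroʳ y))
∧-not-congˡ-¬T         false e = cong (_∧ true) (e (λ ()))

∧-congʳ-T : ∀ c {x y} → (T c → x ≡ y) → c ∧ x ≡ c ∧ y
∧-congʳ-T true  e = e _
∧-congʳ-T false _ = refl

allᵇ-cong : ∀ {A : Set} {g h : A → Bool} → (∀ x → g x ≡ h x) → ∀ xs → allᵇ g xs ≡ allᵇ h xs
allᵇ-cong e []       = refl
allᵇ-cong e (y ∷ ys) = cong₂ _∧_ (e y) (allᵇ-cong e ys)

allᵇ⁻ : ∀ {A : Set} (g : A → Bool) {xs x} → T (allᵇ g xs) → x ∈ xs → T (g x)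
allᵇ⁻ g {y ∷ ys} all (here refl)  = proj₁ (Equivalence.to T-∧ all)
allᵇ⁻ g {y ∷ ys} all (there x∈ys) = allᵇ⁻ g (proj₂ (Equivalence.to T-∧ all)) x∈ys

allᵇ⁺ : ∀ {A : Set} (g : A → Bool) xs → (∀ {x} → x ∈ xs → T (g x)) → T (allᵇ g xs)
allᵇ⁺ g []       all = _
allᵇ⁺ g (y ∷ ys) all = Equivalence.from T-∧ (all (here refl) , allᵇ⁺ g ys (all ∘ there))

allᵇ-lookup : ∀ {A : Set} {m} (g : A → Bool) (w : Vec A m) → T (allᵇ g (toList w)) → ∀ j → T (g (lookup w j))
allᵇ-lookup g (x ∷ w) all zero    = proj₁ (Equivalence.to T-∧ all)
allᵇ-lookup g (x ∷ w) all (suc j) = allᵇ-lookup g w (proj₂ (Equivalence.to T-∧ all)) j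

allᵇ-tabulate-cong : ∀ {A : Set} {k} {g h : A → Bool} (e : Fin k → A) → (∀ j → g (e j) ≡ h (e j)) →
                     allᵇ g (tabulate e) ≡ allᵇ h (tabulate e)
allᵇ-tabulate-cong {k = zero}  e eq = refl
allᵇ-tabulate-cong {k = suc k} e eq = cong₂ _∧_ (eq zero) (allᵇ-tabulate-cong (e ∘ suc) (eq ∘ suc))

count : ∀ {A : Set} → (A → Bool) → List A → ℕ
count g xs = length (filterᵇ g xs)

module _ {A : Set} where

  count-cong : ∀ {g h : A → Bool} → (∀ x → g x ≡ h x) → ∀ xs → count g xs ≡ count h xs
  count-cong e []       = refl
  count-cong {g} {h} e (x ∷ xs) with g x | h x | e x
  ... | true  | .true  | refl = cong suc (count-cong e xs)
  ... | false | .false | refl = count-cong e xs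

  count-split : ∀ (g c : A → Bool) xs → count g xs ≡ count (λ x → g x ∧ not (c x)) xs + count (λ x → g x ∧ c x) xs
  count-split g c []       = refl
  count-split g c (x ∷ xs) with g x | c x
  ... | true  | true  = trans (cong suc (count-split g c xs)) (sym (+-suc _ _))
  ... | true  | false = cong suc (count-split g c xs)
  ... | false | _     = count-split g c xs

  count-∨ : ∀ (g h : A → Bool) → (∀ x → T (g x) → ¬ T (h x)) → ∀ xs →
            count (λ x → g x ∨ h x) xs ≡ count g xs + count h xs
  count-∨ g h disjoint []       = refl
  count-∨ g h disjoint (x ∷ xs) with g x | h x | disjoint x
  ... | true  | true  | both = contradiction _ (both _)
  ... | true  | false | _    = cong suc (count-∨ g h disjoint xs)
  ... | false | true  | _    = trans (cong suc (count-∨ g h disjoint xs)) (sym (+-suc _ _))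
  ... | false | false | _    = count-∨ g h disjoint xs

  count-filterᵇ : ∀ (f g : A → Bool) xs → count g (filterᵇ f xs) ≡ count (λ x → f x ∧ g x) xs
  count-filterᵇ f g []       = refl
  count-filterᵇ f g (x ∷ xs) with f x
  ... | false = count-filterᵇ f g xs
  ... | true with g x
  ...   | true  = cong suc (count-filterᵇ f g xs)
  ...   | false = count-filterᵇ f g xs

module _ {A : Set} (g : A → Bool) where

  count-tabulate-none : ∀ {n} (h : Fin n → A) → (∀ i → ¬ T (g (h i))) → count g (tabulate h) ≡ 0
  count-tabulate-none {zero}  h none = refl
  count-tabulate-none {suc n} h none with g (h zero) in e
  ... | true  = contradiction (subst T (sym e) _) (none zero)
  ... | false = count-tabulate-none (h ∘ suc) (none ∘ suc)

  count-tabulate-unique : ∀ {n} (h : Fin n → A) m → T (g (h m)) → (∀ i → T (g (h i)) → i ≡ m) →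
                          count g (tabulate h) ≡ 1
  count-tabulate-unique h zero gm only with g (h zero)
  ... | true  = cong suc (count-tabulate-none (h ∘ suc) (λ i gi → case (only (suc i) gi) of λ ()))
  ... | false = contradiction gm λ ()
  count-tabulate-unique h (suc m) gm only with g (h zero) in e
  ... | true  = case only zero (subst T (sym e) _) of λ ()
  ... | false = count-tabulate-unique (h ∘ suc) m gm (λ i gi → suc-injective (only (suc i) gi))

least-Fin : ∀ {n} (P : Fin n → Set) → (∀ i → Dec (P i)) → ∃ P → ∃[ m ] P m × (∀ j → P j → toℕ m ≤ toℕ j)
least-Fin {suc n} P P? (x , px) with P? zero | x
... | yes p0 | _     = zero , p0 , λ _ _ → z≤n
... | no ¬p0 | zero  = contradiction px ¬p0
... | no ¬p0 | suc x with least-Fin (P ∘ suc) (P? ∘ suc) (x , px)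
...   | m , pm , least = suc m , pm , λ { zero pj → contradiction pj ¬p0 ; (suc j) pj → s≤s (least j pj) }

least-ℕ : (P : ℕ → Set) → (∀ k → Dec (P k)) → ∃ P → ∃[ m ] P m × (∀ j → j < m → ¬ P j)
least-ℕ P P? (k , pk) with search (suc k)
  where
    search : ∀ bound → (∀ j → j < bound → ¬ P j) ⊎ (∃[ m ] P m × (∀ j → j < m → ¬ P j))
    search zero = inj₁ (λ _ ())
    search (suc bound) with search bound
    ... | inj₂ found = inj₂ found
    ... | inj₁ none with P? bound
    ...   | yes pb = inj₂ (bound , pb , none)
    ...   | no ¬pb = inj₁ λ j j≤bound → case m≤n⇒m<n∨m≡n (≤-pred j≤bound) of λ
              { (inj₁ j<bound) → none j j<bound ; (inj₂ refl) → ¬pb }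
... | inj₁ none  = contradiction pk (none k (n<1+n k))
... | inj₂ found = found

-- Orbits and cycles

iterate : ∀ {A : Set} → (A → A) → ℕ → A → A
iterate f zero    x = x
iterate f (suc k) x = f (iterate f k x)

module _ {A : Set} (f : A → A) where

  iterate-+ : ∀ j k x → iterate f (j + k) x ≡ iterate f j (iterate f k x)
  iterate-+ zero    k x = refl
  iterate-+ (suc j) k x = cong f (iterate-+ j k x)

  iterate-comm : ∀ k x → iterate f k (f x) ≡ f (iterate f k x)
  iterate-comm zero    x = refl
  iterate-comm (suc k) x = cong f (iterate-comm k x)

  iterate-periodic : ∀ {x} q → iterate f q x ≡ x → ∀ m → iterate f (m * q) x ≡ x
  iterate-periodic q e zero    = refl
  iterate-periodic q e (suc m) = trans (iterate-+ q (m * q) _) (trans (cong (iterate f q) (iterate-periodic q e m)) e)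

  iterate-mod : ∀ {x} q .{{_ : NonZero q}} → iterate f q x ≡ x → ∀ k → iterate f k x ≡ iterate f (k % q) x
  iterate-mod {x} q e k = begin
    iterate f k x                                 ≡⟨ cong (λ j → iterate f j x) (m≡m%n+[m/n]*n k q) ⟩
    iterate f (k % q + (k / q) * q) x             ≡⟨ iterate-+ (k % q) _ x ⟩
    iterate f (k % q) (iterate f ((k / q) * q) x) ≡⟨ cong (iterate f (k % q)) (iterate-periodic q e (k / q)) ⟩
    iterate f (k % q) x                           ∎
    where open ≡-Reasoning

  iterate-injective : Injective _≡_ _≡_ f → ∀ k {x y} → iterate f k x ≡ iterate f k y → x ≡ y
  iterate-injective inj zero    e = e
  iterate-injective inj (suc k) e = iterate-injective inj k (inj e)

iterate-cong : ∀ {A : Set} {f g : A → A} → (∀ x → f x ≡ g x) → ∀ k x → iterate f k x ≡ iterate g k x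
iterate-cong e zero    x = refl
iterate-cong {f = f} e (suc k) x = trans (cong f (iterate-cong e k x)) (e _)

Reaches : ∀ {A : Set} → (A → A) → A → A → Set
Reaches f x y = ∃[ k ] iterate f k x ≡ y

module _ {A : Set} (f : A → A) where

  reaches-refl : ∀ {x} → Reaches f x x
  reaches-refl = 0 , refl

  reaches-trans : ∀ {x y z} → Reaches f x y → Reaches f y z → Reaches f x z
  reaches-trans (j , refl) (k , refl) = k + j , iterate-+ f k j _

  reaches-step : ∀ {x y} → Reaches f (f x) y → Reaches f x y
  reaches-step (k , refl) = suc k , sym (iterate-comm f k _)

module _ {n : ℕ} {f : Fin n → Fin n} (inj : Injective _≡_ _≡_ f) where

  period : ∀ x → ∃[ q ] suc q ≤ n × iterate f (suc q) x ≡ x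
  period x with pigeonhole (n<1+n n) (λ k → iterate f (toℕ k) x)
  ... | i , j , i<j , eq = q , q<n , iterate-injective f inj (toℕ i) returns
    where
      q : ℕ
      q = toℕ j ∸ toℕ i ∸ 1
      1+q≡j-i : suc q ≡ toℕ j ∸ toℕ i
      1+q≡j-i = m+[n∸m]≡n (m<n⇒0<n∸m i<j)
      q<n : suc q ≤ n
      q<n = subst (_≤ n) (sym 1+q≡j-i) (≤-trans (m∸n≤m (toℕ j) (toℕ i)) (≤-pred (toℕ<n j)))
      returns : iterate f (toℕ i) (iterate f (suc q) x) ≡ iterate f (toℕ i) x
      returns = begin
        iterate f (toℕ i) (iterate f (suc q) x) ≡⟨ iterate-+ f (toℕ i) (suc q) x ⟨
        iterate f (toℕ i + suc q) x             ≡⟨ cong (λ d → iterate f (toℕ i + d) x) 1+q≡j-i ⟩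
        iterate f (toℕ i + (toℕ j ∸ toℕ i)) x   ≡⟨ cong (λ d → iterate f d x) (m+[n∸m]≡n (<⇒≤ i<j)) ⟩
        iterate f (toℕ j) x                     ≡⟨ eq ⟨
        iterate f (toℕ i) x                     ∎
        where open ≡-Reasoning

  iterate-bounded : ∀ x k → ∃[ r ] r < n × iterate f k x ≡ iterate f r x
  iterate-bounded x k with period x
  ... | q , q<n , e = k % suc q , <-≤-trans (m%n<n k (suc q)) q<n , iterate-mod f (suc q) e k

  reaches-sym : ∀ {x y} → Reaches f x y → Reaches f y x
  reaches-sym {x} (k , refl) with period x
  ... | q , _ , e = suc q ∸ r , back
    where
      r : ℕ
      r = k % suc q
      back : iterate f (suc q ∸ r) (iterate f k x) ≡ x
      back = begin
        iterate f (suc q ∸ r) (iterate f k x) ≡⟨ cong (iterate f (suc q ∸ r)) (iterate-mod f (suc q) e k) ⟩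
        iterate f (suc q ∸ r) (iterate f r x) ≡⟨ iterate-+ f (suc q ∸ r) r x ⟨
        iterate f (suc q ∸ r + r) x           ≡⟨ cong (λ d → iterate f d x) (m∸n+n≡m (<⇒≤ (m%n<n k (suc q)))) ⟩
        iterate f (suc q) x                   ≡⟨ e ⟩
        x                                     ∎
        where open ≡-Reasoning

  reaches? : ∀ x y → Dec (Reaches f x y)
  reaches? x y with any? (λ (k : Fin n) → iterate f (toℕ k) x ≟ y)
  ... | yes (k , e) = yes (toℕ k , e)
  ... | no ¬short   = no λ (k , e) → let r , r<n , e′ = iterate-bounded x k in
    ¬short (fromℕ< r<n , trans (cong (λ d → iterate f d x) (toℕ-fromℕ< r<n)) (trans (sym e′) e))

module _ {n : ℕ} where

  -- isCycleMin and cycles of Defs, stated for maps instead of vectors so that maps can be composed with a transposition.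

  isCycleMinᶠ : (Fin n → Fin n) → Fin n → Bool
  isCycleMinᶠ f i = allᵇ (λ k → toℕ i ≤ᵇ toℕ (iterate f k i)) (upTo n)

  cyclesᶠ : (Fin n → Fin n) → ℕ
  cyclesᶠ f = count (isCycleMinᶠ f) (allFin n)

  isCycleMinᶠ-cong : ∀ {f g} → (∀ x → f x ≡ g x) → ∀ i → isCycleMinᶠ f i ≡ isCycleMinᶠ g i
  isCycleMinᶠ-cong e i = allᵇ-cong (λ k → cong (λ y → toℕ i ≤ᵇ toℕ y) (iterate-cong e k i)) (upTo n)

  cyclesᶠ-cong : ∀ {f g} → (∀ x → f x ≡ g x) → cyclesᶠ f ≡ cyclesᶠ g
  cyclesᶠ-cong e = count-cong (isCycleMinᶠ-cong e) (allFin n)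

  module _ {f : Fin n → Fin n} (inj : Injective _≡_ _≡_ f) where

    isCycleMinᶠ⁻ : ∀ {i} → T (isCycleMinᶠ f i) → ∀ j → Reaches f i j → toℕ i ≤ toℕ j
    isCycleMinᶠ⁻ {i} min j (k , refl) with iterate-bounded inj i k
    ... | r , r<n , e = subst (λ y → toℕ i ≤ toℕ y) (sym e)
                          (≤ᵇ⇒≤ (toℕ i) _ (allᵇ⁻ _ min (∈-upTo⁺ r<n)))

    isCycleMinᶠ⁺ : ∀ {i} → (∀ j → Reaches f i j → toℕ i ≤ toℕ j) → T (isCycleMinᶠ f i)
    isCycleMinᶠ⁺ {i} min = allᵇ⁺ _ (upTo n) (λ {k} _ → ≤⇒≤ᵇ (min _ (k , refl)))

    inOrbit : Fin n → Fin n → Bool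
    inOrbit c i = ⌊ reaches? inj c i ⌋

    inOrbit⁻ : ∀ {c i} → T (inOrbit c i) → Reaches f c i
    inOrbit⁻ = toWitness

    inOrbit⁺ : ∀ {c i} → Reaches f c i → T (inOrbit c i)
    inOrbit⁺ = fromWitness

    count-cycleMin-inOrbit : ∀ c → count (λ i → isCycleMinᶠ f i ∧ inOrbit c i) (allFin n) ≡ 1
    count-cycleMin-inOrbit c with least-Fin (Reaches f c) (reaches? inj c) (c , reaches-refl f)
    ... | m , c⇝m , least = count-tabulate-unique _ (λ i → i) m min-m only-m
      where
        min-m : T (isCycleMinᶠ f m ∧ inOrbit c m)
        min-m = Equivalence.from T-∧
          (isCycleMinᶠ⁺ (λ j m⇝j → least j (reaches-trans f c⇝m m⇝j)) , inOrbit⁺ c⇝m)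
        only-m : ∀ i → T (isCycleMinᶠ f i ∧ inOrbit c i) → i ≡ m
        only-m i mi with Equivalence.to T-∧ mi
        ... | min-i , c⇝i? = toℕ-injective (≤-antisym
                (isCycleMinᶠ⁻ min-i m (reaches-trans f (reaches-sym inj c⇝i) c⇝m)) (least i c⇝i))
          where
            c⇝i : Reaches f c i
            c⇝i = inOrbit⁻ c⇝i?

-- Composing with a transposition

module TransposeProperties {n : ℕ} (a b : Fin n) where

  transpose-at-a : transpose a b a ≡ b
  transpose-at-a rewrite dec-true (a ≟ a) refl = refl

  transpose-at-b : transpose a b b ≡ a
  transpose-at-b with b ≟ a
  ... | yes b≡a = b≡a
  ... | no _ rewrite dec-true (b ≟ b) refl = refl

  transpose-elsewhere : ∀ {x} → x ≢ a → x ≢ b → transpose a b x ≡ x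
  transpose-elsewhere {x} x≢a x≢b rewrite dec-false (x ≟ a) x≢a | dec-false (x ≟ b) x≢b = refl

  a-or-b-or-neither : ∀ x → x ≡ a ⊎ x ≡ b ⊎ (x ≢ a × x ≢ b)
  a-or-b-or-neither x with x ≟ a | x ≟ b
  ... | yes x≡a | _       = inj₁ x≡a
  ... | no _    | yes x≡b = inj₂ (inj₁ x≡b)
  ... | no x≢a  | no x≢b  = inj₂ (inj₂ (x≢a , x≢b))

  transpose-involutive : ∀ x → transpose a b (transpose a b x) ≡ x
  transpose-involutive x with a-or-b-or-neither x
  ... | inj₁ refl               = trans (cong (transpose a b) transpose-at-a) transpose-at-b
  ... | inj₂ (inj₁ refl)        = trans (cong (transpose a b) transpose-at-b) transpose-at-a
  ... | inj₂ (inj₂ (x≢a , x≢b)) = trans (cong (transpose a b) fixed) fixed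
    where
      fixed : transpose a b x ≡ x
      fixed = transpose-elsewhere x≢a x≢b

module ComposeTranspose {n : ℕ} {f : Fin n → Fin n} (inj : Injective _≡_ _≡_ f) {a b : Fin n} (a≢b : a ≢ b) where

  open TransposeProperties a b

  g : Fin n → Fin n
  g = f ∘ transpose a b

  g-injective : Injective _≡_ _≡_ g
  g-injective {x} {y} e = begin
    x                                 ≡⟨ transpose-involutive x ⟨
    transpose a b (transpose a b x)   ≡⟨ cong (transpose a b) (inj e) ⟩
    transpose a b (transpose a b y)   ≡⟨ transpose-involutive y ⟩
    y                                 ∎
    where open ≡-Reasoning

  g-elsewhere : ∀ {x} → x ≢ a → x ≢ b → g x ≡ f x
  g-elsewhere x≢a x≢b = cong f (transpose-elsewhere x≢a x≢b)

  g-at-a : g a ≡ f b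
  g-at-a = cong f transpose-at-a

  reaches-via : ∀ {x y z} → g x ≡ y → Reaches g y z → Reaches g x z
  reaches-via refl = reaches-step g

  g-follows-f-until-b : ∀ d x → (∀ e → e < d → iterate f e x ≢ a) → Reaches g x (iterate f d x) ⊎ Reaches g x b
  g-follows-f-until-b zero    x avoid-a = inj₁ (reaches-refl g)
  g-follows-f-until-b (suc d) x avoid-a with x ≟ b
  ... | yes refl = inj₂ (reaches-refl g)
  ... | no x≢b = Sum.map (reaches-via gx≡fx ∘ subst (Reaches g (f x)) (iterate-comm f d x))
                         (reaches-via gx≡fx)
                         (g-follows-f-until-b d (f x) avoid-a′)
    where
      gx≡fx : g x ≡ f x
      gx≡fx = g-elsewhere (avoid-a 0 (s≤s z≤n)) x≢b
      avoid-a′ : ∀ e → e < d → iterate f e (f x) ≢ a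
      avoid-a′ e e<d eq = avoid-a (suc e) (s≤s e<d) (trans (sym (iterate-comm f e x)) eq)

  merge : ¬ Reaches f a b → Reaches g a b
  merge ¬a⇝b with period inj b
  ... | q , _ , returns =
    reaches-via g-at-a (Sum.[ subst (Reaches g (f b)) fb⇝b , id ] (g-follows-f-until-b q (f b) avoid-a))
    where
      fb⇝b : iterate f q (f b) ≡ b
      fb⇝b = trans (iterate-comm f q b) returns
      avoid-a : ∀ e → e < q → iterate f e (f b) ≢ a
      avoid-a e _ eq = ¬a⇝b (reaches-sym inj (suc e , trans (sym (iterate-comm f e b)) eq))

  -- If a reaches b, then g cuts the cycle of f through a into the cycles of g through a and through b
  -- and leaves every other cycle alone.
  module Split (a⇝b : Reaches f a b) where

    separated : ¬ Reaches g a b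
    separated with least-ℕ (λ j → iterate f j b ≡ a) (λ j → iterate f j b ≟ a) (reaches-sym inj a⇝b)
    ... | zero  , b≡a , _       = λ _ → a≢b (sym b≡a)
    ... | suc j , fʲ⁺¹b≡a , least = λ (k , gᵏa≡b) →
      let e , e≤j , eq = arc-iterate k in no-return e e≤j (trans eq gᵏa≡b)
      where
        no-return : ∀ e → e < suc j → iterate f (suc e) b ≢ b
        no-return e e≤j returns = least (j ∸ e) (s≤s (m∸n≤m j e)) (begin
          iterate f (j ∸ e) b                      ≡⟨ cong (iterate f (j ∸ e)) returns ⟨
          iterate f (j ∸ e) (iterate f (suc e) b)  ≡⟨ iterate-+ f (j ∸ e) (suc e) b ⟨
          iterate f (j ∸ e + suc e) b              ≡⟨ cong (λ d → iterate f d b) j∸e+1+e≡1+j ⟩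
          iterate f (suc j) b                      ≡⟨ fʲ⁺¹b≡a ⟩
          a                                        ∎)
          where
            open ≡-Reasoning
            j∸e+1+e≡1+j : j ∸ e + suc e ≡ suc j
            j∸e+1+e≡1+j = trans (+-suc (j ∸ e) e) (cong suc (m∸n+n≡m (≤-pred e≤j)))

        -- With j + 1 the first time the orbit of b reaches a, the g-orbit of a is f b, f² b, …, f^(j+1) b = a.
        Arc : Fin n → Set
        Arc y = ∃[ e ] e < suc j × iterate f (suc e) b ≡ y

        arc-step : ∀ {y} → Arc y → Arc (g y)
        arc-step (e , e≤j , refl) with a-or-b-or-neither (iterate f (suc e) b)
        ... | inj₁ y≡a                = 0 , s≤s z≤n , sym (trans (cong g y≡a) g-at-a)
        ... | inj₂ (inj₁ y≡b)         = contradiction y≡b (no-return e e≤j)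
        ... | inj₂ (inj₂ (y≢a , y≢b)) = suc e , s≤s (≤∧≢⇒< (≤-pred e≤j) e≢j) , sym (g-elsewhere y≢a y≢b)
          where
            e≢j : e ≢ j
            e≢j refl = y≢a fʲ⁺¹b≡a

        arc-iterate : ∀ k → Arc (iterate g k a)
        arc-iterate zero    = j , n<1+n j , fʲ⁺¹b≡a
        arc-iterate (suc k) = arc-step (arc-iterate k)

    orbit-split : ∀ {i} → Reaches f a i → Reaches g a i ⊎ Reaches g b i
    orbit-split {i} a⇝i with least-ℕ (λ d → iterate f d i ≡ a) (λ d → iterate f d i ≟ a) (reaches-sym inj a⇝i)
    ... | d , fᵈi≡a , least =
      Sum.map (reaches-sym g-injective ∘ subst (Reaches g i) fᵈi≡a) (reaches-sym g-injective) (g-follows-f-until-b d i least)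

    transpose-in-orbit : ∀ {y} → Reaches f a y → Reaches f a (transpose a b y)
    transpose-in-orbit {y} a⇝y with a-or-b-or-neither y
    ... | inj₁ refl               = subst (Reaches f a) (sym transpose-at-a) a⇝b
    ... | inj₂ (inj₁ refl)        = subst (Reaches f a) (sym transpose-at-b) (reaches-refl f)
    ... | inj₂ (inj₂ (y≢a , y≢b)) = subst (Reaches f a) (sym (transpose-elsewhere y≢a y≢b)) a⇝y

    orbit-closed : ∀ {x y} → Reaches f a x → Reaches g x y → Reaches f a y
    orbit-closed a⇝x (zero  , refl) = a⇝x
    orbit-closed a⇝x (suc k , refl) = reaches-trans f (transpose-in-orbit (orbit-closed a⇝x (k , refl))) (1 , refl)

    outside-agree : ∀ {i} → ¬ Reaches f a i → ∀ k → iterate g k i ≡ iterate f k i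
    outside-agree ¬a⇝i zero    = refl
    outside-agree ¬a⇝i (suc k) = trans (cong g (outside-agree ¬a⇝i k)) (g-elsewhere ≢a ≢b)
      where
        ≢a : iterate f k _ ≢ a
        ≢a eq = ¬a⇝i (reaches-sym inj (k , eq))
        ≢b : iterate f k _ ≢ b
        ≢b eq = ¬a⇝i (reaches-trans f a⇝b (reaches-sym inj (k , eq)))

    private
      inside : Fin n → Bool
      inside = inOrbit inj a

    outside-cycleMin : ∀ i → isCycleMinᶠ g i ∧ not (inside i) ≡ isCycleMinᶠ f i ∧ not (inside i)
    outside-cycleMin i = ∧-not-congˡ-¬T (inside i) λ ¬a⇝i →
      allᵇ-cong (λ k → cong (λ y → toℕ i ≤ᵇ toℕ y) (outside-agree (¬a⇝i ∘ inOrbit⁺ inj) k)) (upTo n)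

    inside-split : ∀ i → inside i ≡ inOrbit g-injective a i ∨ inOrbit g-injective b i
    inside-split i = T-injective
      (λ a⇝i → Equivalence.from T-∨ (Sum.map inOrbitᵍ⁺ inOrbitᵍ⁺ (orbit-split (inOrbit⁻ inj a⇝i))))
      (λ g⇝i → inOrbit⁺ inj (Sum.[ orbit-closed (reaches-refl f) , orbit-closed a⇝b ]
                              (Sum.map inOrbitᵍ⁻ inOrbitᵍ⁻ (Equivalence.to T-∨ g⇝i))))
      where
        inOrbitᵍ⁺ : ∀ {c} → Reaches g c i → T (inOrbit g-injective c i)
        inOrbitᵍ⁺ = inOrbit⁺ g-injective
        inOrbitᵍ⁻ : ∀ {c} → T (inOrbit g-injective c i) → Reaches g c i
        inOrbitᵍ⁻ = inOrbit⁻ g-injective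

    inside-cycleMins : count (λ i → isCycleMinᶠ g i ∧ inside i) (allFin n) ≡ 2
    inside-cycleMins = begin
      count (λ i → isCycleMinᶠ g i ∧ inside i) (allFin n)
        ≡⟨ count-cong distribute (allFin n) ⟩
      count (λ i → minIn a i ∨ minIn b i) (allFin n)
        ≡⟨ count-∨ (minIn a) (minIn b) disjoint (allFin n) ⟩
      count (minIn a) (allFin n) + count (minIn b) (allFin n)
        ≡⟨ cong₂ _+_ (count-cycleMin-inOrbit g-injective a) (count-cycleMin-inOrbit g-injective b) ⟩
      2 ∎
      where
        open ≡-Reasoning
        minIn : Fin n → Fin n → Bool
        minIn c i = isCycleMinᶠ g i ∧ inOrbit g-injective c i
        distribute : ∀ i → isCycleMinᶠ g i ∧ inside i ≡ minIn a i ∨ minIn b i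
        distribute i = trans (cong (isCycleMinᶠ g i ∧_) (inside-split i)) (∧-distribˡ-∨ (isCycleMinᶠ g i) _ _)
        disjoint : ∀ i → T (minIn a i) → ¬ T (minIn b i)
        disjoint i in-a in-b = separated (reaches-trans g
          (inOrbit⁻ g-injective (proj₂ (Equivalence.to (T-∧ {isCycleMinᶠ g i}) in-a)))
          (reaches-sym g-injective (inOrbit⁻ g-injective (proj₂ (Equivalence.to (T-∧ {isCycleMinᶠ g i}) in-b)))))

    cyclesᶠ-split : cyclesᶠ g ≡ suc (cyclesᶠ f)
    cyclesᶠ-split = begin
      cyclesᶠ g
        ≡⟨ count-split (isCycleMinᶠ g) inside (allFin n) ⟩
      count (λ i → isCycleMinᶠ g i ∧ not (inside i)) (allFin n) + count (λ i → isCycleMinᶠ g i ∧ inside i) (allFin n)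
        ≡⟨ cong₂ _+_ (count-cong outside-cycleMin (allFin n)) inside-cycleMins ⟩
      outside + 2
        ≡⟨ +-suc outside 1 ⟩
      suc (outside + 1)
        ≡⟨ cong (λ m → suc (outside + m)) (count-cycleMin-inOrbit inj a) ⟨
      suc (outside + count (λ i → isCycleMinᶠ f i ∧ inside i) (allFin n))
        ≡⟨ cong suc (count-split (isCycleMinᶠ f) inside (allFin n)) ⟨
      suc (cyclesᶠ f) ∎
      where
        open ≡-Reasoning
        outside : ℕ
        outside = count (λ i → isCycleMinᶠ f i ∧ not (inside i)) (allFin n)

-- If a and b lie on different cycles of f, they lie on one cycle of g = f ∘ (a b); since f = g ∘ (a b),
-- the split case applied to g shows that f has one cycle more than g.
cyclesᶠ-transpose : ∀ {n} {f : Fin n → Fin n} → Injective _≡_ _≡_ f → ∀ {a b} → a ≢ b →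
                    cyclesᶠ (f ∘ transpose a b) ≡ suc (cyclesᶠ f) ⊎ cyclesᶠ f ≡ suc (cyclesᶠ (f ∘ transpose a b))
cyclesᶠ-transpose {f = f} inj {a} {b} a≢b = case reaches? inj a b of λ
  { (yes a⇝b) → inj₁ (Split.cyclesᶠ-split a⇝b)
  ; (no ¬a⇝b) → inj₂ (trans (cyclesᶠ-cong (λ x → cong f (sym (TransposeProperties.transpose-involutive a b x))))
                            (ComposeTranspose.Split.cyclesᶠ-split g-injective a≢b (merge ¬a⇝b)))
  }
  where open ComposeTranspose inj a≢b

iter≡iterate : ∀ {n} (v : Vec (Fin n) n) k i → iter v k i ≡ iterate (lookup v) k i
iter≡iterate v zero    i = refl
iter≡iterate v (suc k) i = cong (lookup v) (iter≡iterate v k i)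

cycles≡cyclesᶠ : ∀ {n} (v : Vec (Fin n) n) → cycles v ≡ cyclesᶠ (lookup v)
cycles≡cyclesᶠ {n} v =
  count-cong (λ i → allᵇ-cong (λ k → cong (λ y → toℕ i ≤ᵇ toℕ y) (iter≡iterate v k i)) (upTo n)) (allFin n)

cyclesᶠ≤n : ∀ {n} (f : Fin n → Fin n) → cyclesᶠ f ≤ n
cyclesᶠ≤n {n} f = subst (cyclesᶠ f ≤_) (length-tabulate (λ i → i)) (length-filter (T? ∘ isCycleMinᶠ f) (allFin n))

distinct-lookup-injective : ∀ {n m} (w : Vec (Fin n) m) → T (distinct (toList w)) → Injective _≡_ _≡_ (lookup w)
distinct-lookup-injective (x ∷ w) d {zero}  {zero}  eq = refl
distinct-lookup-injective (x ∷ w) d {zero}  {suc j} eq =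
  contradiction eq (toWitnessFalse (allᵇ-lookup _ w (proj₁ (Equivalence.to T-∧ d)) j))
distinct-lookup-injective (x ∷ w) d {suc i} {zero}  eq =
  contradiction (sym eq) (toWitnessFalse (allᵇ-lookup _ w (proj₁ (Equivalence.to T-∧ d)) i))
distinct-lookup-injective (x ∷ w) d {suc i} {suc j} eq =
  cong suc (distinct-lookup-injective w (proj₂ (Equivalence.to T-∧ d)) eq)

isEven-suc : ∀ m → isEven (suc m) ≡ not (isEven m)
isEven-suc zero          = refl
isEven-suc (suc zero)    = refl
isEven-suc (suc (suc m)) = isEven-suc m

isEven-∸-suc : ∀ n c → suc c ≤ n → isEven (n ∸ suc c) ≡ not (isEven (n ∸ c))
isEven-∸-suc (suc n) zero    _         = trans (sym (not-involutive (isEven n))) (cong not (sym (isEven-suc n)))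
isEven-∸-suc (suc n) (suc c) (s≤s c<n) = isEven-∸-suc n c c<n

isEven-∸-adjacent : ∀ {n c c′} → c ≤ n → c′ ≤ n → c′ ≡ suc c ⊎ c ≡ suc c′ →
                    isEven (n ∸ c′) ≡ not (isEven (n ∸ c))
isEven-∸-adjacent {n} {c} _   c′≤n (inj₁ refl) = isEven-∸-suc n c c′≤n
isEven-∸-adjacent {n} {_} {c′} c≤n _ (inj₂ refl) =
  trans (sym (not-involutive _)) (cong not (sym (isEven-∸-suc n c′ c≤n)))

-- Positions are 0-based: this exchanges positions 1 and 3 of the paper, both odd, so PAPs go to PAPs.
swap₀₂ : ∀ {A : Set} {k} → Vec A (3 + k) → Vec A (3 + k)
swap₀₂ (x ∷ y ∷ z ∷ r) = z ∷ y ∷ x ∷ r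

lookup-swap₀₂ : ∀ {A : Set} {k} (v : Vec A (3 + k)) i →
                lookup (swap₀₂ v) i ≡ lookup v (transpose zero (suc (suc zero)) i)
lookup-swap₀₂ (x ∷ y ∷ z ∷ r) zero                = refl
lookup-swap₀₂ (x ∷ y ∷ z ∷ r) (suc zero)          = refl
lookup-swap₀₂ (x ∷ y ∷ z ∷ r) (suc (suc zero))    = refl
lookup-swap₀₂ (x ∷ y ∷ z ∷ r) (suc (suc (suc i))) = refl

isEvenPerm-swap₀₂ : ∀ {k} (v : Vec (Fin (3 + k)) (3 + k)) → T (isPerm v) → isEvenPerm (swap₀₂ v) ≡ not (isEvenPerm v)
isEvenPerm-swap₀₂ {k} v perm = begin
  isEven (3 + k ∸ cycles (swap₀₂ v))         ≡⟨ cong (λ c → isEven (3 + k ∸ c)) cycles-swap ⟩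
  isEven (3 + k ∸ cyclesᶠ (lookup v ∘ τ))    ≡⟨ isEven-∸-adjacent (cyclesᶠ≤n _) (cyclesᶠ≤n (lookup v ∘ τ))
                                                  (cyclesᶠ-transpose (distinct-lookup-injective v perm) 0≢2) ⟩
  not (isEven (3 + k ∸ cyclesᶠ (lookup v)))  ≡⟨ cong (λ c → not (isEven (3 + k ∸ c))) (cycles≡cyclesᶠ v) ⟨
  not (isEven (3 + k ∸ cycles v))            ∎
  where
    open ≡-Reasoning
    τ : Fin (3 + k) → Fin (3 + k)
    τ = transpose zero (suc (suc zero))
    0≢2 : zero ≢ suc (suc zero)
    0≢2 ()
    cycles-swap : cycles (swap₀₂ v) ≡ cyclesᶠ (lookup v ∘ τ)
    cycles-swap = trans (cycles≡cyclesᶠ (swap₀₂ v)) (cyclesᶠ-cong (lookup-swap₀₂ v))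

≢ᵇ-sym : ∀ {n} (x y : Fin n) → not ⌊ x ≟ y ⌋ ≡ not ⌊ y ≟ x ⌋
≢ᵇ-sym x y = cong not (T-injective (fromWitness ∘ sym ∘ toWitness) (fromWitness ∘ sym ∘ toWitness))

distinct-swap₀₂ : ∀ {n k} (v : Vec (Fin n) (3 + k)) → distinct (toList (swap₀₂ v)) ≡ distinct (toList v)
distinct-swap₀₂ {n} (x ∷ y ∷ z ∷ r) = begin
  (z≢y ∧ (z≢x ∧ z∉r)) ∧ ((y≢x ∧ y∉r) ∧ (x∉r ∧ d))
    ≡⟨ cong₂ (λ zy zx → (zy ∧ (zx ∧ z∉r)) ∧ ((y≢x ∧ y∉r) ∧ (x∉r ∧ d))) (≢ᵇ-sym z y) (≢ᵇ-sym z x) ⟩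
  (y≢z ∧ (x≢z ∧ z∉r)) ∧ ((y≢x ∧ y∉r) ∧ (x∉r ∧ d))
    ≡⟨ cong (λ yx → (y≢z ∧ (x≢z ∧ z∉r)) ∧ ((yx ∧ y∉r) ∧ (x∉r ∧ d))) (≢ᵇ-sym y x) ⟩
  (y≢z ∧ (x≢z ∧ z∉r)) ∧ ((x≢y ∧ y∉r) ∧ (x∉r ∧ d))
    ≡⟨ ∧-solve 7 (λ xy xz yz x∉ y∉ z∉ d → (yz ∧′ (xz ∧′ z∉)) ∧′ ((xy ∧′ y∉) ∧′ (x∉ ∧′ d))
                                     ⊜ (xy ∧′ (xz ∧′ x∉)) ∧′ ((yz ∧′ y∉) ∧′ (z∉ ∧′ d)))
               refl x≢y x≢z y≢z x∉r y∉r z∉r d ⟩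
  (x≢y ∧ (x≢z ∧ x∉r)) ∧ ((y≢z ∧ y∉r) ∧ (z∉r ∧ d))
    ∎
  where
    open ≡-Reasoning
    _≢ᵇ_ : Fin n → Fin n → Bool
    s ≢ᵇ t = not ⌊ s ≟ t ⌋
    x≢y x≢z y≢z y≢x z≢x z≢y x∉r y∉r z∉r d : Bool
    x≢y = x ≢ᵇ y ; x≢z = x ≢ᵇ z ; y≢z = y ≢ᵇ z ; y≢x = y ≢ᵇ x ; z≢x = z ≢ᵇ x ; z≢y = z ≢ᵇ y
    x∉r = allᵇ (x ≢ᵇ_) (toList r) ; y∉r = allᵇ (y ≢ᵇ_) (toList r) ; z∉r = allᵇ (z ≢ᵇ_) (toList r)
    d = distinct (toList r)

parityAlternating-swap₀₂ : ∀ {k} (v : Vec (Fin (3 + k)) (3 + k)) → parityAlternating (swap₀₂ v) ≡ parityAlternating v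
parityAlternating-swap₀₂ {k} v@(x ∷ y ∷ z ∷ r) = begin
  ok z zero ∧ (ok y one ∧ (ok x two ∧ rest (swap₀₂ v)))
    ≡⟨ cong (λ t → ok z zero ∧ (ok y one ∧ (ok x two ∧ t))) rest-swap ⟩
  ok z zero ∧ (ok y one ∧ (ok x two ∧ rest v))
    -- ok c zero and ok c two are definitionally equal, so the first and third conjuncts may trade places.
    ≡⟨ ∧-solve 4 (λ a b c t → a ∧′ (b ∧′ (c ∧′ t)) ⊜ c ∧′ (b ∧′ (a ∧′ t))) refl
                 (ok z zero) (ok y one) (ok x two) (rest v) ⟩
  ok x zero ∧ (ok y one ∧ (ok z two ∧ rest v))
    ∎
  where
    open ≡-Reasoning
    one two : Fin (3 + k)
    one = suc zero
    two = suc (suc zero)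
    ok : Fin (3 + k) → Fin (3 + k) → Bool
    ok c i = if isEven (toℕ c) then isEven (toℕ i) else not (isEven (toℕ i))
    okAt : Vec (Fin (3 + k)) (3 + k) → Fin (3 + k) → Bool
    okAt w i = ok (lookup w i) i
    later : Fin k → Fin (3 + k)
    later j = suc (suc (suc j))
    rest : Vec (Fin (3 + k)) (3 + k) → Bool
    rest w = allᵇ (okAt w) (tabulate later)
    rest-swap : rest (swap₀₂ v) ≡ rest v
    rest-swap = allᵇ-tabulate-cong {g = okAt (swap₀₂ v)} {okAt v} later (λ _ → refl)

isPAP-swap₀₂ : ∀ {k} (v : Vec (Fin (3 + k)) (3 + k)) → isPAP (swap₀₂ v) ≡ isPAP v
isPAP-swap₀₂ v = cong₂ _∧_ (distinct-swap₀₂ v) (parityAlternating-swap₀₂ v)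

∑ : ∀ {A : Set} → List A → (A → ℕ) → ℕ
∑ []       φ = 0
∑ (x ∷ xs) φ = φ x + ∑ xs φ

syntax ∑ xs (λ x → e) = ∑[ x ← xs ] e

module _ {A : Set} where

  ∑-cong : ∀ (xs : List A) {φ ψ} → (∀ x → φ x ≡ ψ x) → ∑ xs φ ≡ ∑ xs ψ
  ∑-cong []       e = refl
  ∑-cong (x ∷ xs) e = cong₂ _+_ (e x) (∑-cong xs e)

  ∑-++ : ∀ (xs ys : List A) φ → ∑ (xs ++ ys) φ ≡ ∑ xs φ + ∑ ys φ
  ∑-++ []       ys φ = refl
  ∑-++ (x ∷ xs) ys φ = trans (cong (φ x +_) (∑-++ xs ys φ)) (sym (+-assoc (φ x) _ _))

  ∑-+ : ∀ (xs : List A) φ ψ → ∑[ x ← xs ] (φ x + ψ x) ≡ ∑ xs φ + ∑ xs ψ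
  ∑-+ []       φ ψ = refl
  ∑-+ (x ∷ xs) φ ψ = trans (cong (φ x + ψ x +_) (∑-+ xs φ ψ)) (interchange (φ x) (ψ x) _ _)

  ∑-zero : ∀ (xs : List A) → ∑[ x ← xs ] 0 ≡ 0
  ∑-zero []       = refl
  ∑-zero (x ∷ xs) = ∑-zero xs

  count≡∑ : ∀ (g : A → Bool) xs → count g xs ≡ ∑[ x ← xs ] (if g x then 1 else 0)
  count≡∑ g []       = refl
  count≡∑ g (x ∷ xs) with g x
  ... | true  = cong suc (count≡∑ g xs)
  ... | false = count≡∑ g xs

∑-comm : ∀ {A B : Set} (xs : List A) (ys : List B) (φ : A → B → ℕ) →
         ∑[ x ← xs ] ∑[ y ← ys ] φ x y ≡ ∑[ y ← ys ] ∑[ x ← xs ] φ x y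
∑-comm []       ys φ = sym (∑-zero ys)
∑-comm (x ∷ xs) ys φ = trans (cong (∑ ys (φ x) +_) (∑-comm xs ys φ)) (sym (∑-+ ys (φ x) _))

∑-reverse₃ : ∀ {A : Set} (xs : List A) (φ : A → A → A → ℕ) →
             ∑[ c ← xs ] ∑[ b ← xs ] ∑[ a ← xs ] φ a b c ≡ ∑[ c ← xs ] ∑[ b ← xs ] ∑[ a ← xs ] φ c b a
∑-reverse₃ xs φ = begin
  ∑[ c ← xs ] ∑[ b ← xs ] ∑[ a ← xs ] φ a b c   ≡⟨ ∑-cong xs (λ c → ∑-comm xs xs (λ b a → φ a b c)) ⟩
  ∑[ c ← xs ] ∑[ a ← xs ] ∑[ b ← xs ] φ a b c   ≡⟨ ∑-comm xs xs (λ c a → ∑[ b ← xs ] φ a b c) ⟩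
  ∑[ a ← xs ] ∑[ c ← xs ] ∑[ b ← xs ] φ a b c   ≡⟨ ∑-cong xs (λ a → ∑-comm xs xs (λ c b → φ a b c)) ⟩
  ∑[ a ← xs ] ∑[ b ← xs ] ∑[ c ← xs ] φ a b c   ∎
  where open ≡-Reasoning

∑-map : ∀ {A B : Set} (h : A → B) xs (φ : B → ℕ) → ∑ (map h xs) φ ≡ ∑[ x ← xs ] φ (h x)
∑-map h []       φ = refl
∑-map h (x ∷ xs) φ = cong (φ (h x) +_) (∑-map h xs φ)

∑-concatMap : ∀ {A B : Set} (F : A → List B) xs (φ : B → ℕ) → ∑ (concatMap F xs) φ ≡ ∑[ x ← xs ] ∑ (F x) φ
∑-concatMap F []       φ = refl
∑-concatMap F (x ∷ xs) φ = trans (∑-++ (F x) _ φ) (cong (∑ (F x) φ +_) (∑-concatMap F xs φ))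

∑-words-suc : ∀ {m n} φ → ∑ (words m (suc n)) φ ≡ ∑[ v ← words m n ] ∑[ a ← allFin m ] φ (a ∷ v)
∑-words-suc {m} {n} φ = trans (∑-concatMap (λ v → map (_∷ v) (allFin m)) (words m n) φ)
                              (∑-cong (words m n) (λ v → ∑-map (_∷ v) (allFin m) φ))

∑-words-3+ : ∀ {m k} φ → ∑ (words m (3 + k)) φ ≡
             ∑[ r ← words m k ] ∑[ c ← allFin m ] ∑[ b ← allFin m ] ∑[ a ← allFin m ] φ (a ∷ b ∷ c ∷ r)
∑-words-3+ {m} {k} φ = begin
  ∑ (words m (3 + k)) φ
    ≡⟨ ∑-words-suc φ ⟩
  ∑[ w ← words m (2 + k) ] ∑[ a ← allFin m ] φ (a ∷ w)
    ≡⟨ ∑-words-suc (λ w → ∑[ a ← allFin m ] φ (a ∷ w)) ⟩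
  ∑[ u ← words m (1 + k) ] ∑[ b ← allFin m ] ∑[ a ← allFin m ] φ (a ∷ b ∷ u)
    ≡⟨ ∑-words-suc (λ u → ∑[ b ← allFin m ] ∑[ a ← allFin m ] φ (a ∷ b ∷ u)) ⟩
  ∑[ r ← words m k ] ∑[ c ← allFin m ] ∑[ b ← allFin m ] ∑[ a ← allFin m ] φ (a ∷ b ∷ c ∷ r)
    ∎
  where open ≡-Reasoning

count-swap₀₂ : ∀ {m k} (h : Vec (Fin m) (3 + k) → Bool) →
               count (h ∘ swap₀₂) (words m (3 + k)) ≡ count h (words m (3 + k))
count-swap₀₂ {m} {k} h = begin
  count (h ∘ swap₀₂) (words m (3 + k))
    ≡⟨ trans (count≡∑ (h ∘ swap₀₂) (words m (3 + k))) (∑-words-3+ {m} {k} (λ v → ⟦ h (swap₀₂ v) ⟧)) ⟩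
  ∑[ r ← words m k ] ∑[ c ← allFin m ] ∑[ b ← allFin m ] ∑[ a ← allFin m ] ⟦ h (c ∷ b ∷ a ∷ r) ⟧
    ≡⟨ ∑-cong (words m k) (λ r → ∑-reverse₃ (allFin m) (λ a b c → ⟦ h (a ∷ b ∷ c ∷ r) ⟧)) ⟨
  ∑[ r ← words m k ] ∑[ c ← allFin m ] ∑[ b ← allFin m ] ∑[ a ← allFin m ] ⟦ h (a ∷ b ∷ c ∷ r) ⟧
    ≡⟨ trans (count≡∑ h (words m (3 + k))) (∑-words-3+ {m} {k} (λ v → ⟦ h v ⟧)) ⟨
  count h (words m (3 + k))
    ∎
  where
    open ≡-Reasoning
    ⟦_⟧ : Bool → ℕ
    ⟦ b ⟧ = if b then 1 else 0

-- Counting PAPs by sign and generating functions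

p≡pᵒ+pᵉ : ∀ n → p n ≡ pᵒ n + pᵉ n
p≡pᵒ+pᵉ n = trans (count-split isPAP isEvenPerm (words n n))
                  (sym (cong₂ _+_ (count-filterᵇ isPAP _ (words n n)) (count-filterᵇ isPAP isEvenPerm (words n n))))

pᵉ≡pᵒ : ∀ k → pᵉ (3 + k) ≡ pᵒ (3 + k)
pᵉ≡pᵒ k = begin
  pᵉ (3 + k)                                              ≡⟨ count-filterᵇ isPAP isEvenPerm W ⟩
  count (λ v → isPAP v ∧ isEvenPerm v) W                  ≡⟨ count-swap₀₂ {3 + k} {k} (λ v → isPAP v ∧ isEvenPerm v) ⟨
  count (λ v → isPAP (swap₀₂ v) ∧ isEvenPerm (swap₀₂ v)) W ≡⟨ count-cong sign-reversing W ⟩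
  count (λ v → isPAP v ∧ not (isEvenPerm v)) W            ≡⟨ count-filterᵇ isPAP _ W ⟨
  pᵒ (3 + k)                                              ∎
  where
    open ≡-Reasoning
    W : List (Vec (Fin (3 + k)) (3 + k))
    W = words (3 + k) (3 + k)
    sign-reversing : ∀ v → isPAP (swap₀₂ v) ∧ isEvenPerm (swap₀₂ v) ≡ isPAP v ∧ not (isEvenPerm v)
    sign-reversing v = trans (cong (_∧ isEvenPerm (swap₀₂ v)) (isPAP-swap₀₂ v))
      (∧-congʳ-T (isPAP v) (λ pap → isEvenPerm-swap₀₂ v (proj₁ (Equivalence.to T-∧ pap))))

numerator-/-+ : ∀ x y d .{{_ : NonZero d}} → (ℤ.+ (x + y) ℚ./ d) ≡ (ℤ.+ x ℚ./ d) ℚ.+ (ℤ.+ y ℚ./ d)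
numerator-/-+ x y d@(suc d-1) = ℚₚ.toℚᵘ-injective (begin
  toℚᵘ (ℤ.+ (x + y) ℚ./ d)            ≈⟨ ℚₚ.toℚᵘ-fromℚᵘ (mkℚᵘ (ℤ.+ (x + y)) d-1) ⟩
  mkℚᵘ (ℤ.+ (x + y)) d-1              ≈⟨ *≡* cross-multiplied ⟩
  mkℚᵘ X d-1 ℚᵘ.+ mkℚᵘ Y d-1          ≈⟨ ℚᵘₚ.+-cong (ℚₚ.toℚᵘ-fromℚᵘ (mkℚᵘ X d-1)) (ℚₚ.toℚᵘ-fromℚᵘ (mkℚᵘ Y d-1)) ⟨
  toℚᵘ (X ℚ./ d) ℚᵘ.+ toℚᵘ (Y ℚ./ d)  ≈⟨ ℚₚ.toℚᵘ-homo-+ (X ℚ./ d) (Y ℚ./ d) ⟨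
  toℚᵘ (X ℚ./ d ℚ.+ Y ℚ./ d)          ∎)
  where
    open ℚᵘₚ.≃-Reasoning
    X Y D : ℤ.ℤ
    X = ℤ.+ x
    Y = ℤ.+ y
    D = ℤ.+ d
    cross-multiplied : ℤ.+ (x + y) ℤ.* ℤ.+ (d * d) ≡ (X ℤ.* D ℤ.+ Y ℤ.* D) ℤ.* D
    cross-multiplied = trans (cong₂ ℤ._*_ (ℤₚ.pos-+ x y) (ℤₚ.pos-* d d))
      (solve 3 (λ X Y D → (X :+ Y) :* (D :* D) := (X :* D :+ Y :* D) :* D) refl X Y D)
      where open ℤ-Solver

P≡Pᵒ+Pᵉ : ∀ n → P n ≡ Pᵒ n ℚ.+ Pᵉ n
P≡Pᵒ+Pᵉ n = trans (cong (λ m → egf (λ _ → m) n) (p≡pᵒ+pᵉ n)) (numerator-/-+ (pᵒ n) (pᵉ n) (n !) {{n !≢0}})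

Pᵉ≡Pᵒ : ∀ k → Pᵉ (3 + k) ≡ Pᵒ (3 + k)
Pᵉ≡Pᵒ k = cong (λ m → egf (λ _ → m) (3 + k)) (pᵉ≡pᵒ k)

half-of-double : ∀ q → ½ ℚ.* ((q ℚ.+ q) ℚ.+ 0ℚ) ≡ q
half-of-double q = begin
  ½ ℚ.* ((q ℚ.+ q) ℚ.+ 0ℚ) ≡⟨ cong (½ ℚ.*_) (ℚₚ.+-identityʳ (q ℚ.+ q)) ⟩
  ½ ℚ.* (q ℚ.+ q)          ≡⟨ ℚₚ.*-distribˡ-+ ½ q q ⟩
  ½ ℚ.* q ℚ.+ ½ ℚ.* q      ≡⟨ ℚₚ.*-distribʳ-+ q ½ ½ ⟨
  (½ ℚ.+ ½) ℚ.* q          ≡⟨ ℚₚ.*-identityˡ q ⟩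
  q                        ∎
  where open ≡-Reasoning

half-P≡Pᵉ : ∀ k → ½ ℚ.* (P (3 + k) ℚ.+ 0ℚ) ≡ Pᵉ (3 + k)
half-P≡Pᵉ k = begin
  ½ ℚ.* (P n ℚ.+ 0ℚ)               ≡⟨ cong (λ q → ½ ℚ.* (q ℚ.+ 0ℚ)) (P≡Pᵒ+Pᵉ n) ⟩
  ½ ℚ.* ((Pᵒ n ℚ.+ Pᵉ n) ℚ.+ 0ℚ)    ≡⟨ cong (λ q → ½ ℚ.* ((q ℚ.+ Pᵉ n) ℚ.+ 0ℚ)) (Pᵉ≡Pᵒ k) ⟨
  ½ ℚ.* ((Pᵉ n ℚ.+ Pᵉ n) ℚ.+ 0ℚ)    ≡⟨ half-of-double (Pᵉ n) ⟩
  Pᵉ n                             ∎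
  where
    open ≡-Reasoning
    n : ℕ
    n = 3 + k

corollary1 : (∀ n → Pᵉ n ≡ (½ ⊛ (P ⊕ quad)) n) × (∀ n → Pᵒ n ≡ (½ ⊛ (P ⊖ quad)) n)
corollary1 = even , odd
  where
    even : ∀ n → Pᵉ n ≡ (½ ⊛ (P ⊕ quad)) n
    even 0                   = refl
    even 1                   = refl
    even 2                   = refl
    even (suc (suc (suc k))) = sym (half-P≡Pᵉ k)

    odd : ∀ n → Pᵒ n ≡ (½ ⊛ (P ⊖ quad)) n
    odd 0                   = refl
    odd 1                   = refl
    odd 2                   = refl
    -- From degree 3 on, quad vanishes and ℚ.- 0ℚ computes to ℚ.+ 0ℚ.
    odd (suc (suc (suc k))) = sym (trans (half-P≡Pᵉ k) (Pᵉ≡Pᵒ k))
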